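{- Let $G$ be a connected graph of order $n\ge 2$ with $V(G)=\{u_1,\ldots,u_n\}$ and let $\mathcal{H}=\{H_1,\ldots,H_n\}$ be a family of $n$ non-trivial graphs, $H_i$ of order $n_i$. The graph $G\circ\mathcal{H}$ is $2$-metric dimensional if and only if at least one of the following holds: (i) some $H_i\in\mathcal{H}$ has twins; (ii) there exist two true twin vertices $u_i,u_j\in V(G)$ such that $\Delta(H_i)=n_i-1$ and $\Delta(H_j)=n_j-1$; (iii) there exist two false twin vertices $u_i,u_j\in V(G)$ such that $H_i$ and $H_j$ each contain at least one isolated vertex.
   Context: All graphs are finite and simple; non-trivial means at least two vertices. Distinct vertices $x,y$ are true twins if $N[x]=N[y]$, false twins if $N(x)=N(y)$, and twins if either holds. The lexicographic product $G\circ\mathcal{H}$ has vertex set $\bigcup_i\{u_i\}\times V(H_i)$, with $(u_i,v)\sim(u_j,w)$ iff $u_iu_j\in E(G)$, or $i=j$ and $vw\in E(H_i)$. A connected graph $X$ is $k$-metric dimensional if $k$ is the largest integer for which there is a set $S\subseteq V(X)$ such that every two distinct vertices $x,y$ admit at least $k$ vertices $w\in S$ with $d_X(x,w)\neq d_X(y,w)$. -}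

module Defs where

open import Data.Nat using (ℕ; zero; suc; _≤_; _⊔_)
open import Data.Bool using (Bool; true; false; T; if_then_else_)
open import Data.Fin using (Fin)
open import Data.List using (List; map; foldr; allFin)
open import Data.Nat.ListAction using (sum)
open import Data.Product using (Σ; ∃; ∃-syntax; _×_; _,_)
open import Data.Sum using (_⊎_)
open import Function using (_∘_)
open import Function.Bundles using (_⇔_)
open import Function.Definitions using (Injective)
open import Relation.Nullary using (¬_)
open import Relation.Binary.PropositionalEquality using (_≡_; _≢_; subst)

record Graph (n : ℕ) : Set where
  field
    adj    : Fin n → Fin n → Bool
    sym    : ∀ u v → adj u v ≡ adj v u
    irrefl : ∀ u → adj u u ≡ false
open Graph public

Adj : ∀ {n} → Graph n → Fin n → Fin n → Set
Adj G u v = T (adj G u v)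

degree : ∀ {n} → Graph n → Fin n → ℕ
degree {n} G v = sum (map (λ w → if adj G v w then 1 else 0) (allFin n))

Δ : ∀ {n} → Graph n → ℕ
Δ {n} G = foldr _⊔_ 0 (map (degree G) (allFin n))

TrueTwins : ∀ {n} → Graph n → Fin n → Fin n → Set
TrueTwins G x y = x ≢ y × (∀ z → (z ≡ x ⊎ Adj G x z) ⇔ (z ≡ y ⊎ Adj G y z))

FalseTwins : ∀ {n} → Graph n → Fin n → Fin n → Set
FalseTwins G x y = x ≢ y × (∀ z → Adj G x z ⇔ Adj G y z)

HasTwins : ∀ {n} → Graph n → Set
HasTwins G = ∃[ x ] ∃[ y ] (TrueTwins G x y ⊎ FalseTwins G x y)

IsIsolated : ∀ {n} → Graph n → Fin n → Set
IsIsolated G v = ∀ w → ¬ Adj G v w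

HasIsolated : ∀ {n} → Graph n → Set
HasIsolated G = ∃[ v ] IsIsolated G v

-- Lexicographic product G ∘ H, vertex set ⋃ᵢ {uᵢ} × V(Hᵢ)

LexV : ∀ {n} → (Fin n → ℕ) → Set
LexV {n} m = Σ (Fin n) (Fin ∘ m)

LexAdj : ∀ {n} {m : Fin n → ℕ} → Graph n → ((i : Fin n) → Graph (m i)) →
         LexV m → LexV m → Set
LexAdj {m = m} G H (i , v) (j , w) =
  Adj G i j ⊎ (Σ (i ≡ j) λ p → Adj (H j) (subst (Fin ∘ m) p v) w)

module Metric {V : Set} (R : V → V → Set) where

  data Walk : V → V → ℕ → Set where
    here : ∀ {x} → Walk x x 0
    step : ∀ {x y z k} → R x y → Walk y z k → Walk x z (suc k)

  Connected : Set
  Connected = ∀ x y → ∃[ k ] Walk x y k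

  IsDist : V → V → ℕ → Set
  IsDist x y d = Walk x y d × (∀ k → Walk x y k → d ≤ k)

  Distinguishes : V → V → V → Set
  Distinguishes w x y = ∀ d₁ d₂ → IsDist x w d₁ → IsDist y w d₂ → d₁ ≢ d₂

  IsKMetricGenerator : ℕ → (V → Set) → Set
  IsKMetricGenerator k S =
    ∀ x y → x ≢ y →
      Σ (Fin k → V) λ f → Injective _≡_ _≡_ f × (∀ j → S (f j) × Distinguishes (f j) x y)

  HasKMetricGenerator : ℕ → Set₁
  HasKMetricGenerator k = Σ (V → Set) (IsKMetricGenerator k)

  KMetricDimensional : ℕ → Set₁
  KMetricDimensional k =
    HasKMetricGenerator k × (∀ k′ → HasKMetricGenerator k′ → k′ ≤ k)

-- A connected graph always has a 2-metric generator: x and y are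
-- distinguished by x and by y themselves. If x, y are twins, i.e.
-- N(x) ∖ {y} = N(y) ∖ {x}, every other vertex is equidistant from them, so
-- no k-metric generator with k ≥ 3 exists; if there are no twins, any x ≠ y
-- have a third vertex adjacent to exactly one of them, so the whole vertex
-- set is a 3-metric generator. Hence the graph is 2-metric dimensional iff
-- it has twins. In G ∘ H, two vertices of the fibre over uᵢ are twins iff
-- they are twins in Hᵢ, and vertices over uᵢ ≠ uⱼ are twins iff uᵢ, uⱼ are
-- true twins and both vertices are universal in their fibres, or false
-- twins and both are isolated; finally Hᵢ has a universal vertex iff
-- Δ(Hᵢ) = nᵢ - 1.

module Submission where

open import Defs hiding (sym)
open import Data.Bool using (Bool; true; false; T; if_then_else_)
open import Data.Empty using (⊥-elim)
open import Data.Fin using (Fin; zero; suc; punchIn; punchOut; fromℕ<)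
open import Data.Fin.Properties using (punchInᵢ≢i; punchIn-punchOut; injective⇒≤; any?)
  renaming (_≟_ to _≟ᶠ_)
open import Data.List using (map; tabulate; allFin)
open import Data.List.Membership.Propositional.Properties
  using (∈-allFin; ∈-map⁺; ∈-map⁻; foldr-selective)
open import Data.List.Properties using (map-tabulate; foldr-preservesᵇ; foldr-preservesᵒ)
open import Data.List.Relation.Unary.All using (universal)
open import Data.List.Relation.Unary.All.Properties using () renaming (map⁺ to All-map⁺)
open import Data.List.Relation.Unary.Any using () renaming (map to Any-map)
open import Data.Nat using (ℕ; zero; suc; _+_; _∸_; _≤_; _<_; z≤n; s≤s)
open import Data.Nat.ListAction using (sum)
open import Data.Nat.Properties
  using ( +-commutativeSemigroup; ≤-refl; ≤-trans; ≤-antisym; +-mono-≤; <-irrefl; n≤1+n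
        ; ⊔-lub; ⊔-sel; m≤n⇒m≤n⊔o; m≤n⇒m≤o⊔n)
open import Data.Product using (Σ; ∃; ∃₂; ∃-syntax; _×_; _,_; proj₁; proj₂)
open import Data.Product.Properties using (≡-dec)
open import Data.Sum using (_⊎_; inj₁; inj₂; [_,_]′)
open import Data.Unit using (⊤; tt)
open import Data.Vec.Functional using ([]; _∷_)
open import Function using (_∘_; id)
open import Function.Bundles using (_⇔_; mk⇔; Equivalence)
open import Function.Definitions using (Injective)
import Function.Properties.Equivalence as ⇔
open import Relation.Nullary using (¬_; Dec; yes; no)
open import Relation.Nullary.Decidable using (_×-dec_; _⊎-dec_; ¬?; T?; map′)
open import Relation.Binary.Definitions using (DecidableEquality)
open import Relation.Binary.PropositionalEquality
  using (_≡_; _≢_; refl; sym; trans; subst; cong; module ≡-Reasoning)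

open import Algebra.Properties.CommutativeSemigroup +-commutativeSemigroup using (x∙yz≈y∙xz)

open Equivalence using (to; from)

sum-tabulate-punchIn : ∀ {n} (f : Fin (suc n) → ℕ) i →
  sum (tabulate f) ≡ f i + sum (tabulate (f ∘ punchIn i))
sum-tabulate-punchIn f zero = refl
sum-tabulate-punchIn {suc n} f (suc i) = begin
  f zero + sum (tabulate (f ∘ suc))
    ≡⟨ cong (f zero +_) (sum-tabulate-punchIn (f ∘ suc) i) ⟩
  f zero + (f (suc i) + sum (tabulate (f ∘ suc ∘ punchIn i)))
    ≡⟨ x∙yz≈y∙xz (f zero) (f (suc i)) _ ⟩
  f (suc i) + sum (tabulate (f ∘ punchIn (suc i))) ∎
  where open ≡-Reasoning

sum-tabulate-≤ : ∀ {n} (f : Fin n → ℕ) → (∀ i → f i ≤ 1) → sum (tabulate f) ≤ n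
sum-tabulate-≤ {zero} f f≤1 = z≤n
sum-tabulate-≤ {suc n} f f≤1 = +-mono-≤ (f≤1 zero) (sum-tabulate-≤ (f ∘ suc) (f≤1 ∘ suc))

sum-tabulate-< : ∀ {n} (f : Fin n → ℕ) i → (∀ j → f j ≤ 1) → f i ≡ 0 → sum (tabulate f) < n
sum-tabulate-< {suc n} f i f≤1 fi≡0 rewrite sum-tabulate-punchIn f i | fi≡0 =
  s≤s (sum-tabulate-≤ (f ∘ punchIn i) (f≤1 ∘ punchIn i))

sum-tabulate-ones : ∀ {n} (f : Fin n → ℕ) → (∀ i → f i ≡ 1) → sum (tabulate f) ≡ n
sum-tabulate-ones {zero} f f≡1 = refl
sum-tabulate-ones {suc n} f f≡1 rewrite f≡1 zero = cong suc (sum-tabulate-ones (f ∘ suc) (f≡1 ∘ suc))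

adj-sym : ∀ {n} (G : Graph n) {u v} → Adj G u v → Adj G v u
adj-sym G {u} {v} = subst T (Graph.sym G u v)

adj-irrefl : ∀ {n} (G : Graph n) {u} → ¬ Adj G u u
adj-irrefl G {u} = subst T (Graph.irrefl G u)

Universal : ∀ {n} → Graph n → Fin n → Set
Universal G v = ∀ w → w ≢ v → Adj G v w

𝟙 : Bool → ℕ
𝟙 b = if b then 1 else 0

𝟙≤1 : ∀ b → 𝟙 b ≤ 1
𝟙≤1 true = s≤s z≤n
𝟙≤1 false = z≤n

degree-punchIn : ∀ {n} (G : Graph (suc n)) v →
  degree G v ≡ sum (tabulate (λ j → 𝟙 (adj G v (punchIn v j))))
degree-punchIn G v = begin
  degree G v               ≡⟨ cong sum (map-tabulate id neighbour) ⟩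
  sum (tabulate neighbour) ≡⟨ sum-tabulate-punchIn neighbour v ⟩
  𝟙 (adj G v v) + rest     ≡⟨ cong (λ b → 𝟙 b + rest) (Graph.irrefl G v) ⟩
  rest                     ∎
  where
  open ≡-Reasoning
  neighbour : Fin _ → ℕ
  neighbour w = 𝟙 (adj G v w)
  rest : ℕ
  rest = sum (tabulate (neighbour ∘ punchIn v))

degree≤n∸1 : ∀ {n} (G : Graph n) v → degree G v ≤ n ∸ 1
degree≤n∸1 {suc n} G v rewrite degree-punchIn G v = sum-tabulate-≤ _ (λ j → 𝟙≤1 _)

universal⇒degree≡n∸1 : ∀ {n} (G : Graph n) {v} → Universal G v → degree G v ≡ n ∸ 1
universal⇒degree≡n∸1 {suc n} G {v} v-universal rewrite degree-punchIn G v =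
  sum-tabulate-ones _ (λ j → 𝟙-T (v-universal (punchIn v j) (punchInᵢ≢i v j)))
  where
  𝟙-T : ∀ {b} → T b → 𝟙 b ≡ 1
  𝟙-T {true} _ = refl

degree≡n∸1⇒universal : ∀ {n} (G : Graph n) {v} → degree G v ≡ n ∸ 1 → Universal G v
degree≡n∸1⇒universal {suc n} G {v} deg w w≢v with adj G v w in vw
... | true = tt
... | false = ⊥-elim (<-irrefl deg (subst (_< n) (sym (degree-punchIn G v)) fewer))
  where
  fewer : sum (tabulate (λ j → 𝟙 (adj G v (punchIn v j)))) < n
  fewer = sum-tabulate-< _ (punchOut (w≢v ∘ sym)) (λ j → 𝟙≤1 _)
    (subst (λ u → 𝟙 (adj G v u) ≡ 0) (sym (punchIn-punchOut (w≢v ∘ sym))) (cong 𝟙 vw))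

degree≤Δ : ∀ {n} (G : Graph n) v → degree G v ≤ Δ G
degree≤Δ {n} G v =
  foldr-preservesᵒ {P = degree G v ≤_} (λ x y → [ m≤n⇒m≤n⊔o y , m≤n⇒m≤o⊔n x ]′) 0 _
  (inj₂ (Any-map (λ { refl → ≤-refl }) (∈-map⁺ (degree G) (∈-allFin v))))

Δ≤ : ∀ {n} (G : Graph n) {b} → (∀ v → degree G v ≤ b) → Δ G ≤ b
Δ≤ {n} G {b} bound = foldr-preservesᵇ {P = _≤ b} ⊔-lub z≤n (All-map⁺ (universal bound (allFin n)))

Δ-attained : ∀ {n} (G : Graph n) → Fin n → ∃ λ v → degree G v ≡ Δ G
Δ-attained {n} G u with foldr-selective ⊔-sel 0 (map (degree G) (allFin n))
... | inj₁ Δ≡0 = u , ≤-antisym (degree≤Δ G u) (subst (_≤ degree G u) (sym Δ≡0) z≤n)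
... | inj₂ Δ∈ with ∈-map⁻ (degree G) Δ∈
...   | v , _ , Δ≡deg = v , sym Δ≡deg

Δ≡n∸1⇔universal : ∀ {n} (G : Graph n) → 0 < n → Δ G ≡ n ∸ 1 ⇔ ∃ (Universal G)
Δ≡n∸1⇔universal {suc n} G _ = mk⇔ maxDegree⇒universal universal⇒maxDegree
  where
  maxDegree⇒universal : Δ G ≡ n → ∃ (Universal G)
  maxDegree⇒universal Δ≡n with Δ-attained G zero
  ... | v , deg≡Δ = v , degree≡n∸1⇒universal G (trans deg≡Δ Δ≡n)
  universal⇒maxDegree : ∃ (Universal G) → Δ G ≡ n
  universal⇒maxDegree (v , v-universal) = ≤-antisym (Δ≤ G (degree≤n∸1 G))
    (subst (_≤ Δ G) (universal⇒degree≡n∸1 G v-universal) (degree≤Δ G v))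

module _ {V : Set} (R : V → V → Set) where

  Nbhd⊆ : V → V → Set
  Nbhd⊆ x y = ∀ z → z ≢ x → z ≢ y → R x z → R y z

  Twins : V → V → Set
  Twins x y = x ≢ y × Nbhd⊆ x y × Nbhd⊆ y x

module _ {n} (K : Graph n) where

  TrueTwins-sym : ∀ {x y} → TrueTwins K x y → TrueTwins K y x
  TrueTwins-sym (x≢y , same) = x≢y ∘ sym , ⇔.sym ∘ same

  FalseTwins-sym : ∀ {x y} → FalseTwins K x y → FalseTwins K y x
  FalseTwins-sym (x≢y , same) = x≢y ∘ sym , ⇔.sym ∘ same

  true-twins⇒twins : ∀ {x y} → TrueTwins K x y → Twins (Adj K) x y
  true-twins⇒twins (x≢y , same) = x≢y , open⊆ (to ∘ same) , open⊆ (from ∘ same)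
    where
    open⊆ : ∀ {a b} → (∀ z → z ≡ a ⊎ Adj K a z → z ≡ b ⊎ Adj K b z) → Nbhd⊆ (Adj K) a b
    open⊆ closed⊆ z _ z≢b az with closed⊆ z (inj₂ az)
    ... | inj₁ z≡b = ⊥-elim (z≢b z≡b)
    ... | inj₂ bz = bz

  false-twins⇒twins : ∀ {x y} → FalseTwins K x y → Twins (Adj K) x y
  false-twins⇒twins (x≢y , same) = x≢y , (λ z _ _ → to (same z)) , (λ z _ _ → from (same z))

  twins⇒true-twins : ∀ {x y} → Adj K x y → Twins (Adj K) x y → TrueTwins K x y
  twins⇒true-twins xy (x≢y , x⊆y , y⊆x) =
    x≢y , λ z → mk⇔ (closed⊆ xy x⊆y z) (closed⊆ (adj-sym K xy) y⊆x z)
    where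
    closed⊆ : ∀ {a b} → Adj K a b → Nbhd⊆ (Adj K) a b →
              ∀ z → z ≡ a ⊎ Adj K a z → z ≡ b ⊎ Adj K b z
    closed⊆ ab a⊆b z (inj₁ refl) = inj₂ (adj-sym K ab)
    closed⊆ {b = b} ab a⊆b z (inj₂ az) with z ≟ᶠ b
    ... | yes z≡b = inj₁ z≡b
    ... | no z≢b = inj₂ (a⊆b z (λ { refl → adj-irrefl K az }) z≢b az)

  twins⇒false-twins : ∀ {x y} → ¬ Adj K x y → Twins (Adj K) x y → FalseTwins K x y
  twins⇒false-twins ¬xy (x≢y , x⊆y , y⊆x) = x≢y , λ z → mk⇔
    (λ xz → x⊆y z (λ { refl → adj-irrefl K xz }) (λ { refl → ¬xy xz }) xz)
    (λ yz → y⊆x z (λ { refl → adj-irrefl K yz }) (λ { refl → ¬xy (adj-sym K yz) }) yz)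

  twins⇔true-or-false-twins : ∀ {x y} → Twins (Adj K) x y ⇔ (TrueTwins K x y ⊎ FalseTwins K x y)
  twins⇔true-or-false-twins {x} {y} = mk⇔ classify [ true-twins⇒twins , false-twins⇒twins ]′
    where
    classify : Twins (Adj K) x y → TrueTwins K x y ⊎ FalseTwins K x y
    classify twins with T? (adj K x y)
    ... | yes xy = inj₁ (twins⇒true-twins xy twins)
    ... | no ¬xy = inj₂ (twins⇒false-twins ¬xy twins)

module _ {A : Set} where

  injective-into-pair⇒≤2 : ∀ {k x y} (f : Fin k → A) → Injective _≡_ _≡_ f →
                           (∀ j → f j ≡ x ⊎ f j ≡ y) → k ≤ 2
  injective-into-pair⇒≤2 f f-injective x-or-y = injective⇒≤ {f = side} side-injective
    where
    side : Fin _ → Fin 2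
    side j = [ (λ _ → zero) , (λ _ → suc zero) ]′ (x-or-y j)
    side-injective : Injective _≡_ _≡_ side
    side-injective {i} {j} _ with x-or-y i | x-or-y j
    side-injective {i} {j} () | inj₁ _ | inj₂ _
    side-injective {i} {j} () | inj₂ _ | inj₁ _
    ... | inj₁ fi≡x | inj₁ fj≡x = f-injective (trans fi≡x (sym fj≡x))
    ... | inj₂ fi≡y | inj₂ fj≡y = f-injective (trans fi≡y (sym fj≡y))

  ∷-injective : ∀ {k x} {f : Fin k → A} → (∀ j → f j ≢ x) → Injective _≡_ _≡_ f →
                Injective _≡_ _≡_ (x ∷ f)
  ∷-injective fresh f-injective {zero} {zero} _ = refl
  ∷-injective fresh f-injective {zero} {suc j} x≡fj = ⊥-elim (fresh j (sym x≡fj))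
  ∷-injective fresh f-injective {suc i} {zero} fi≡x = ⊥-elim (fresh i fi≡x)
  ∷-injective fresh f-injective {suc i} {suc j} fi≡fj = cong suc (f-injective fi≡fj)

  []-injective : Injective _≡_ _≡_ ([] {A = A})
  []-injective {()}

least-witness : {P : ℕ → Set} → (∀ k → Dec (P k)) → ∀ {n} → P n →
                ∃ λ d → P d × (∀ k → P k → d ≤ k)
least-witness P? {n} pn with P? 0
... | yes p0 = 0 , p0 , λ _ _ → z≤n
least-witness P? {zero} p0 | no ¬p0 = ⊥-elim (¬p0 p0)
least-witness P? {suc n} pn | no ¬p0 with least-witness (P? ∘ suc) pn
... | d , pd , minimal = suc d , pd , λ { zero p0 → ⊥-elim (¬p0 p0) ; (suc k) pk → s≤s (minimal k pk) }

module _ {V : Set} {R : V → V → Set} where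
  open Metric R

  walk₀⇒≡ : ∀ {x y} → Walk x y 0 → x ≡ y
  walk₀⇒≡ here = refl

  walk⇒successor : ∀ {x y k} → x ≢ y → Walk x y k → ∃ (R x)
  walk⇒successor x≢y here = ⊥-elim (x≢y refl)
  walk⇒successor x≢y (step xz _) = _ , xz

module MetricDimension {V : Set} (R : V → V → Set) (_≟_ : DecidableEquality V)
  (R? : ∀ x y → Dec (R x y)) (R-irrefl : ∀ x → ¬ R x x)
  (any? : ∀ {P : V → Set} → (∀ x → Dec (P x)) → Dec (∃ P)) where
  open Metric R

  walk? : ∀ k x w → Dec (Walk x w k)
  walk? zero x w with x ≟ w
  ... | yes refl = yes here
  ... | no x≢w = no (x≢w ∘ walk₀⇒≡)
  walk? (suc k) x w = map′ (λ (y , xy , walk) → step xy walk) (λ { (step xy walk) → _ , xy , walk })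
    (any? (λ y → R? x y ×-dec walk? k y w))

  distance : Connected → ∀ x w → ∃ (IsDist x w)
  distance connected x w = least-witness (λ k → walk? k x w) (proj₂ (connected x w))

  -- A walk from x to w starts with x → y (drop that step) or with x → z
  -- for some z ≠ y (start with y → z instead).
  Nbhd⊆⇒shorter-walk : ∀ {x y w k} → Nbhd⊆ R x y → w ≢ x → Walk x w k →
                       ∃ λ k′ → Walk y w k′ × k′ ≤ k
  Nbhd⊆⇒shorter-walk x⊆y w≢x here = ⊥-elim (w≢x refl)
  Nbhd⊆⇒shorter-walk {x} {y} x⊆y w≢x (step {y = z} {k = k} xz walk) with z ≟ y
  ... | yes refl = k , walk , n≤1+n k
  ... | no z≢y = suc k , step (x⊆y z (λ { refl → R-irrefl x xz }) z≢y xz) walk , ≤-refl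

  twins-equidistant : ∀ {x y w d₁ d₂} → Twins R x y → w ≢ x → w ≢ y →
                      IsDist x w d₁ → IsDist y w d₂ → d₁ ≡ d₂
  twins-equidistant (_ , x⊆y , y⊆x) w≢x w≢y (walk₁ , shortest₁) (walk₂ , shortest₂)
    with Nbhd⊆⇒shorter-walk x⊆y w≢x walk₁ | Nbhd⊆⇒shorter-walk y⊆x w≢y walk₂
  ... | k , walk , k≤d₁ | k′ , walk′ , k′≤d₂ =
    ≤-antisym (≤-trans (shortest₁ k′ walk′) k′≤d₂) (≤-trans (shortest₂ k walk) k≤d₁)

  twins-distinguished-only-by-themselves : Connected → ∀ {x y w} → Twins R x y →
                                           Distinguishes w x y → w ≡ x ⊎ w ≡ y
  twins-distinguished-only-by-themselves connected {x} {y} {w} twins distinguishes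
    with w ≟ x | w ≟ y
  ... | yes w≡x | _ = inj₁ w≡x
  ... | no _ | yes w≡y = inj₂ w≡y
  ... | no w≢x | no w≢y with distance connected x w | distance connected y w
  ... | d₁ , dist₁ | d₂ , dist₂ =
    ⊥-elim (distinguishes d₁ d₂ dist₁ dist₂ (twins-equidistant twins w≢x w≢y dist₁ dist₂))

  twins⇒generators≤2 : Connected → ∀ {x y} → Twins R x y → ∀ k → HasKMetricGenerator k → k ≤ 2
  twins⇒generators≤2 connected twins@(x≢y , _) k (S , generator) with generator _ _ x≢y
  ... | f , f-injective , distinguishing = injective-into-pair⇒≤2 f f-injective
    (λ j → twins-distinguished-only-by-themselves connected twins (proj₂ (distinguishing j)))

  Distinguishers : ℕ → V → V → Set
  Distinguishers k x y = Σ (Fin k → V) λ f → Injective _≡_ _≡_ f × (∀ j → Distinguishes (f j) x y)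

  generator-of-distinguishers : ∀ {k} → (∀ x y → x ≢ y → Distinguishers k x y) →
                                HasKMetricGenerator k
  generator-of-distinguishers distinguishers = (λ _ → ⊤) , λ x y x≢y →
    let f , f-injective , distinguishing = distinguishers x y x≢y
    in f , f-injective , λ j → tt , distinguishing j

  distinguishes-sym : ∀ {w x y} → Distinguishes w x y → Distinguishes w y x
  distinguishes-sym distinguishes d₁ d₂ dist₁ dist₂ d₁≡d₂ =
    distinguishes d₂ d₁ dist₂ dist₁ (sym d₁≡d₂)

  distinguishes-self : ∀ {x y} → x ≢ y → Distinguishes x x y
  distinguishes-self x≢y d₁ d₂ (_ , shortest) (walk , _) d₁≡d₂
    with ≤-antisym (shortest 0 here) z≤n
  ... | refl with d₁≡d₂
  ... | refl = x≢y (sym (walk₀⇒≡ walk))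

  distinguishes-out-neighbour : ∀ {x y z} → R x z → ¬ R y z → Distinguishes z x y
  distinguishes-out-neighbour {x} xz _ zero _ (here , _) _ _ = R-irrefl x xz
  distinguishes-out-neighbour xz ¬yz (suc zero) _ _ (step yz here , _) refl = ¬yz yz
  distinguishes-out-neighbour xz ¬yz (suc (suc d)) _ (_ , shortest) _ _ with shortest 1 (step xz here)
  ... | s≤s ()

  hasGenerator₂ : HasKMetricGenerator 2
  hasGenerator₂ = generator-of-distinguishers λ x y x≢y →
    (x ∷ y ∷ []) , ∷-injective (λ { zero → x≢y ∘ sym }) (∷-injective (λ ()) []-injective) ,
    λ { zero → distinguishes-self x≢y
      ; (suc zero) → distinguishes-sym (distinguishes-self (x≢y ∘ sym)) }

  Separates : V → V → V → Set
  Separates x y z = z ≢ x × z ≢ y × (R x z × ¬ R y z ⊎ R y z × ¬ R x z)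

  separates? : ∀ x y z → Dec (Separates x y z)
  separates? x y z = ¬? (z ≟ x) ×-dec ¬? (z ≟ y) ×-dec
    ((R? x z ×-dec ¬? (R? y z)) ⊎-dec (R? y z ×-dec ¬? (R? x z)))

  separated⇒¬twins : ∀ {x y} → ∃ (Separates x y) → ¬ Twins R x y
  separated⇒¬twins (z , z≢x , z≢y , inj₁ (xz , ¬yz)) (_ , x⊆y , _) = ¬yz (x⊆y z z≢x z≢y xz)
  separated⇒¬twins (z , z≢x , z≢y , inj₂ (yz , ¬xz)) (_ , _ , y⊆x) = ¬xz (y⊆x z z≢y z≢x yz)

  unseparated⇒Nbhd⊆ : ∀ {x y} → ¬ ∃ (Separates x y) → Nbhd⊆ R x y × Nbhd⊆ R y x
  unseparated⇒Nbhd⊆ {x} {y} unseparated = x⊆y , y⊆x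
    where
    x⊆y : Nbhd⊆ R x y
    x⊆y z z≢x z≢y xz with R? y z
    ... | yes yz = yz
    ... | no ¬yz = ⊥-elim (unseparated (z , z≢x , z≢y , inj₁ (xz , ¬yz)))
    y⊆x : Nbhd⊆ R y x
    y⊆x z z≢y z≢x yz with R? x z
    ... | yes xz = xz
    ... | no ¬xz = ⊥-elim (unseparated (z , z≢x , z≢y , inj₂ (yz , ¬xz)))

  twins? : ∀ x y → Dec (Twins R x y)
  twins? x y with x ≟ y | any? (separates? x y)
  ... | yes x≡y | _ = no λ (x≢y , _) → x≢y x≡y
  ... | no _ | yes separated = no (separated⇒¬twins separated)
  ... | no x≢y | no unseparated = yes (x≢y , unseparated⇒Nbhd⊆ unseparated)

  twin-free⇒hasGenerator₃ : (∀ x y → ¬ Twins R x y) → HasKMetricGenerator 3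
  twin-free⇒hasGenerator₃ twin-free =
    generator-of-distinguishers λ x y x≢y → triple x≢y (separator x≢y)
    where
    separator : ∀ {x y} → x ≢ y → ∃ (Separates x y)
    separator {x} {y} x≢y with any? (separates? x y)
    ... | yes separated = separated
    ... | no unseparated = ⊥-elim (twin-free x y (x≢y , unseparated⇒Nbhd⊆ unseparated))
    triple : ∀ {x y} → x ≢ y → ∃ (Separates x y) → Distinguishers 3 x y
    triple {x} {y} x≢y (z , z≢x , z≢y , z-separates) =
      (x ∷ y ∷ z ∷ []) ,
      ∷-injective (λ { zero → x≢y ∘ sym ; (suc zero) → z≢x })
        (∷-injective (λ { zero → z≢y }) (∷-injective (λ ()) []-injective)) ,
      λ { zero → distinguishes-self x≢y
        ; (suc zero) → distinguishes-sym (distinguishes-self (x≢y ∘ sym))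
        ; (suc (suc zero)) →
            [ (λ (xz , ¬yz) → distinguishes-out-neighbour xz ¬yz)
            , (λ (yz , ¬xz) → distinguishes-sym (distinguishes-out-neighbour yz ¬xz))
            ]′ z-separates }

  2-metric-dimensional⇔twins : Connected → KMetricDimensional 2 ⇔ ∃₂ (Twins R)
  2-metric-dimensional⇔twins connected = mk⇔ twins-exist λ (x , y , twins) →
    hasGenerator₂ , twins⇒generators≤2 connected twins
    where
    twins-exist : KMetricDimensional 2 → ∃₂ (Twins R)
    twins-exist (_ , maximal) with any? (λ x → any? (twins? x))
    ... | yes twins = twins
    ... | no no-twins with maximal 3 (twin-free⇒hasGenerator₃ λ x y twins → no-twins (x , y , twins))
    ...   | s≤s (s≤s ())

module LexicographicProduct {n} {m : Fin n → ℕ} (G : Graph n) (H : (i : Fin n) → Graph (m i))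
  (fibre-nonempty : ∀ i → 0 < m i) where

  Lex : LexV m → LexV m → Set
  Lex = LexAdj G H

  point : ∀ i → Fin (m i)
  point i = fromℕ< (fibre-nonempty i)

  _≟_ : DecidableEquality (LexV m)
  _≟_ = ≡-dec _≟ᶠ_ _≟ᶠ_

  lex-adj? : ∀ x y → Dec (Lex x y)
  lex-adj? (i , v) (j , w) = T? (adj G i j) ⊎-dec fibre-adj? i j v w
    where
    fibre-adj? : ∀ i j v w → Dec (Σ (i ≡ j) λ p → Adj (H j) (subst (Fin ∘ m) p v) w)
    fibre-adj? i j v w with i ≟ᶠ j
    ... | no i≢j = no λ (i≡j , _) → i≢j i≡j
    ... | yes refl = map′ (refl ,_) (λ { (refl , vw) → vw }) (T? (adj (H i) v w))

  lex-irrefl : ∀ x → ¬ Lex x x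
  lex-irrefl (i , v) (inj₁ ii) = adj-irrefl G ii
  lex-irrefl (i , v) (inj₂ (refl , vv)) = adj-irrefl (H i) vv

  lex-any? : ∀ {P : LexV m → Set} → (∀ x → Dec (P x)) → Dec (∃ P)
  lex-any? P? = map′ (λ (i , v , p) → (i , v) , p) (λ ((i , v) , p) → i , v , p)
    (any? λ i → any? λ v → P? (i , v))

  module G = Metric (Adj G)
  module L = Metric Lex

  lift-walk : ∀ {i j k} → G.Walk i j (suc k) → ∀ v w → L.Walk (i , v) (j , w) (suc k)
  lift-walk (G.step ij G.here) v w = L.step (inj₁ ij) L.here
  lift-walk (G.step ij walk@(G.step _ _)) v w = L.step (inj₁ ij) (lift-walk walk (point _) w)

  -- Two vertices of one fibre are joined through any vertex of a neighbouring fibre.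
  lex-connected : (∀ i → ∃ (Adj G i)) → G.Connected → L.Connected
  lex-connected neighbour connected (i , v) (j , w) with connected i j
  ... | suc k , walk = suc k , lift-walk walk v w
  ... | zero , G.here with neighbour i
  ...   | z , iz = 2 , L.step {y = z , point z} (inj₁ iz) (L.step (inj₁ (adj-sym G iz)) L.here)

  Nbhd⊆-fibre⁺ : ∀ {i v w} → Nbhd⊆ (Adj (H i)) v w → Nbhd⊆ Lex (i , v) (i , w)
  Nbhd⊆-fibre⁺ v⊆w (k , c) _ _ (inj₁ ik) = inj₁ ik
  Nbhd⊆-fibre⁺ v⊆w (k , c) c≢v c≢w (inj₂ (refl , vc)) =
    inj₂ (refl , v⊆w c (λ { refl → c≢v refl }) (λ { refl → c≢w refl }) vc)

  Nbhd⊆-fibre⁻ : ∀ {i v w} → Nbhd⊆ Lex (i , v) (i , w) → Nbhd⊆ (Adj (H i)) v w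
  Nbhd⊆-fibre⁻ {i} v⊆w c c≢v c≢w vc
    with v⊆w (i , c) (λ { refl → c≢v refl }) (λ { refl → c≢w refl }) (inj₂ (refl , vc))
  ... | inj₁ ii = ⊥-elim (adj-irrefl G ii)
  ... | inj₂ (refl , wc) = wc

  fibre-twins⇔ : ∀ {i v w} → Twins Lex (i , v) (i , w) ⇔ Twins (Adj (H i)) v w
  fibre-twins⇔ = mk⇔
    (λ (x≢y , x⊆y , y⊆x) → (λ { refl → x≢y refl }) , Nbhd⊆-fibre⁻ x⊆y , Nbhd⊆-fibre⁻ y⊆x)
    (λ (v≢w , v⊆w , w⊆v) → (λ { refl → v≢w refl }) , Nbhd⊆-fibre⁺ v⊆w , Nbhd⊆-fibre⁺ w⊆v)

  Nbhd⊆-base : ∀ {i j v w} → Nbhd⊆ Lex (i , v) (j , w) → Nbhd⊆ (Adj G) i j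
  Nbhd⊆-base x⊆y z z≢i z≢j iz
    with x⊆y (z , point z) (λ { refl → z≢i refl }) (λ { refl → z≢j refl }) (inj₁ iz)
  ... | inj₁ jz = jz
  ... | inj₂ (j≡z , _) = ⊥-elim (z≢j (sym j≡z))

  cross-twins⇒base-twins : ∀ {i j v w} → i ≢ j → Twins Lex (i , v) (j , w) → Twins (Adj G) i j
  cross-twins⇒base-twins i≢j (_ , x⊆y , y⊆x) = i≢j , Nbhd⊆-base x⊆y , Nbhd⊆-base y⊆x

  Nbhd⊆-adjacent⇒universal : ∀ {i j v w} → i ≢ j → Adj G j i → Nbhd⊆ Lex (j , w) (i , v) →
                             Universal (H i) v
  Nbhd⊆-adjacent⇒universal {i} i≢j ji y⊆x c c≢v
    with y⊆x (i , c) (λ { refl → i≢j refl }) (λ { refl → c≢v refl }) (inj₁ ji)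
  ... | inj₁ ii = ⊥-elim (adj-irrefl G ii)
  ... | inj₂ (refl , vc) = vc

  Nbhd⊆-nonadjacent⇒isolated : ∀ {i j v w} → i ≢ j → ¬ Adj G j i → Nbhd⊆ Lex (i , v) (j , w) →
                               IsIsolated (H i) v
  Nbhd⊆-nonadjacent⇒isolated {i} i≢j ¬ji x⊆y c vc
    with x⊆y (i , c) (λ { refl → adj-irrefl (H i) vc }) (λ { refl → i≢j refl }) (inj₂ (refl , vc))
  ... | inj₁ ji = ¬ji ji
  ... | inj₂ (j≡i , _) = i≢j (sym j≡i)

  true-twins-universal⇒Nbhd⊆ : ∀ {i j v w} → TrueTwins G i j → Universal (H j) w →
                               Nbhd⊆ Lex (i , v) (j , w)
  true-twins-universal⇒Nbhd⊆ {j = j} (i≢j , same) w-universal (k , c) _ y≢z (inj₁ ik)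
    with k ≟ᶠ j | to (same k) (inj₂ ik)
  ... | yes refl | _ = inj₂ (refl , w-universal c (λ { refl → y≢z refl }))
  ... | no k≢j | inj₁ k≡j = ⊥-elim (k≢j k≡j)
  ... | no _ | inj₂ jk = inj₁ jk
  true-twins-universal⇒Nbhd⊆ {i} (i≢j , same) _ (k , c) _ _ (inj₂ (refl , _))
    with to (same i) (inj₁ refl)
  ... | inj₁ i≡j = ⊥-elim (i≢j i≡j)
  ... | inj₂ ji = inj₁ ji

  false-twins-isolated⇒Nbhd⊆ : ∀ {i j v w} → FalseTwins G i j → IsIsolated (H i) v →
                               Nbhd⊆ Lex (i , v) (j , w)
  false-twins-isolated⇒Nbhd⊆ (_ , same) _ (k , _) _ _ (inj₁ ik) = inj₁ (to (same k) ik)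
  false-twins-isolated⇒Nbhd⊆ _ v-isolated (_ , c) _ _ (inj₂ (refl , vc)) = ⊥-elim (v-isolated c vc)

  cross-twins-classified : ∀ {i j v w} → i ≢ j → Twins Lex (i , v) (j , w) →
    TrueTwins G i j × Universal (H i) v × Universal (H j) w
    ⊎ FalseTwins G i j × IsIsolated (H i) v × IsIsolated (H j) w
  cross-twins-classified {i} {j} i≢j twins@(_ , x⊆y , y⊆x) with T? (adj G i j)
  ... | yes ij = inj₁ (twins⇒true-twins G ij (cross-twins⇒base-twins i≢j twins) ,
                       Nbhd⊆-adjacent⇒universal i≢j (adj-sym G ij) y⊆x ,
                       Nbhd⊆-adjacent⇒universal (i≢j ∘ sym) ij x⊆y)
  ... | no ¬ij = inj₂ (twins⇒false-twins G ¬ij (cross-twins⇒base-twins i≢j twins) ,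
                       Nbhd⊆-nonadjacent⇒isolated i≢j (¬ij ∘ adj-sym G) x⊆y ,
                       Nbhd⊆-nonadjacent⇒isolated (i≢j ∘ sym) ¬ij y⊆x)

  TwinCondition : Set
  TwinCondition =
    (∃[ i ] HasTwins (H i))
    ⊎ (∃[ i ] ∃[ j ] (TrueTwins G i j × Δ (H i) ≡ m i ∸ 1 × Δ (H j) ≡ m j ∸ 1))
    ⊎ (∃[ i ] ∃[ j ] (FalseTwins G i j × HasIsolated (H i) × HasIsolated (H j)))

  lex-twins⇔twin-condition : ∃₂ (Twins Lex) ⇔ TwinCondition
  lex-twins⇔twin-condition = mk⇔ classify construct
    where
    Δ⇔universal : ∀ i → Δ (H i) ≡ m i ∸ 1 ⇔ ∃ (Universal (H i))
    Δ⇔universal i = Δ≡n∸1⇔universal (H i) (fibre-nonempty i)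

    classify : ∃₂ (Twins Lex) → TwinCondition
    classify ((i , v) , (j , w) , twins) with i ≟ᶠ j
    ... | yes refl = inj₁ (i , v , w , to (twins⇔true-or-false-twins (H i)) (to fibre-twins⇔ twins))
    ... | no i≢j with cross-twins-classified i≢j twins
    ...   | inj₁ (true-twins , v-universal , w-universal) =
      inj₂ (inj₁ (i , j , true-twins , from (Δ⇔universal i) (v , v-universal)
                                     , from (Δ⇔universal j) (w , w-universal)))
    ...   | inj₂ (false-twins , v-isolated , w-isolated) =
      inj₂ (inj₂ (i , j , false-twins , (v , v-isolated) , (w , w-isolated)))

    construct : TwinCondition → ∃₂ (Twins Lex)
    construct (inj₁ (i , v , w , true-or-false)) =
      (i , v) , (i , w) , from fibre-twins⇔ (from (twins⇔true-or-false-twins (H i)) true-or-false)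
    construct (inj₂ (inj₁ (i , j , true-twins@(i≢j , _) , Δᵢ , Δⱼ)))
      with to (Δ⇔universal i) Δᵢ | to (Δ⇔universal j) Δⱼ
    ... | v , v-universal | w , w-universal =
      (i , v) , (j , w) , i≢j ∘ cong proj₁ ,
      true-twins-universal⇒Nbhd⊆ true-twins w-universal ,
      true-twins-universal⇒Nbhd⊆ (TrueTwins-sym G true-twins) v-universal
    construct (inj₂ (inj₂ (i , j , false-twins@(i≢j , _) , (v , v-isolated) , (w , w-isolated)))) =
      (i , v) , (j , w) , i≢j ∘ cong proj₁ ,
      false-twins-isolated⇒Nbhd⊆ false-twins v-isolated ,
      false-twins-isolated⇒Nbhd⊆ (FalseTwins-sym G false-twins) w-isolated

corollary8 : (n : ℕ) → 2 ≤ n → (G : Graph n) → Metric.Connected (Adj G) →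
    (m : Fin n → ℕ) → (∀ i → 2 ≤ m i) → (H : (i : Fin n) → Graph (m i)) →
    Metric.KMetricDimensional (LexAdj G H) 2 ⇔
    ((∃[ i ] HasTwins (H i))
    ⊎ (∃[ i ] ∃[ j ] (TrueTwins G i j × Δ (H i) ≡ m i ∸ 1 × Δ (H j) ≡ m j ∸ 1))
    ⊎ (∃[ i ] ∃[ j ] (FalseTwins G i j × HasIsolated (H i) × HasIsolated (H j))))
corollary8 (suc zero) (s≤s ()) _ _ _ _ _
corollary8 (suc (suc n)) _ G connected m non-trivial H =
  ⇔.trans (2-metric-dimensional⇔twins (lex-connected neighbour connected)) lex-twins⇔twin-condition
  where
  open LexicographicProduct G H (λ i → ≤-trans (s≤s z≤n) (non-trivial i))
  open MetricDimension Lex _≟_ lex-adj? lex-irrefl lex-any?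
  neighbour : ∀ i → ∃ (Adj G i)
  neighbour i = walk⇒successor (punchInᵢ≢i i zero ∘ sym) (proj₂ (connected i (punchIn i zero)))
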